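{- Let $n\ge sk$ and let $\mathcal{F}_1,\dots,\mathcal{F}_s\subset\binom{[n]}{k}$ be cross-dependent. Then \[ \sum_{i=1}^s|\mathcal{F}_i|\le(s-1)\binom nk. \]
   Context: $\binom{[n]}{k}$ is the family of $k$-element subsets of $[n]=\{1,\dots,n\}$. Families $\mathcal{F}_1,\dots,\mathcal{F}_s$ are cross-dependent if there are no pairwise disjoint sets $F_1,\dots,F_s$ with $F_i\in\mathcal{F}_i$ for all $i\in[s]$. -}

module Defs where

open import Data.Nat using (ℕ)
open import Data.Fin using (Fin)
open import Data.Fin.Subset using (Subset; ∣_∣; _∩_; Empty)
open import Data.List using (List)
open import Data.List.Membership.Propositional using (_∈_)
open import Data.List.Relation.Unary.All using (All)
open import Data.List.Relation.Unary.Unique.Propositional using (Unique)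
open import Data.Product using (Σ; _×_)
open import Relation.Binary.PropositionalEquality using (_≡_)
open import Relation.Nullary using (¬_)

-- A family 𝓕 ⊆ binom([n],k), given as a duplicate-free list of k-subsets of Fin n.
-- Its cardinality |𝓕| is the length of the list.
IsKFamily : (n k : ℕ) → List (Subset n) → Set
IsKFamily n k 𝓕 = Unique 𝓕 × All (λ F → ∣ F ∣ ≡ k) 𝓕

Disjoint : {n : ℕ} → Subset n → Subset n → Set
Disjoint A B = Empty (A ∩ B)

CrossDependent : {n s : ℕ} → (Fin s → List (Subset n)) → Set
CrossDependent {n} {s} 𝓕 =
  ¬ (Σ (Fin s → Subset n) λ F →
       ((i : Fin s) → F i ∈ 𝓕 i) ×
       ((i j : Fin s) → ¬ (i ≡ j) → Disjoint (F i) (F j)))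

-- Average over the ordered s-tuples (B₁, …, Bₛ) of pairwise disjoint k-sets, of which there are
-- c·C(n,k) > 0 since n ≥ sk. Every coordinate Bᵢ runs through each k-set exactly c times, so
-- summing the number of hits #{i ∣ Bᵢ ∈ 𝓕ᵢ} over all tuples gives c·Σ|𝓕ᵢ|. Cross-dependence
-- says that no tuple hits all s families, and each tuple hits each family at most once, so the
-- same sum is at most (s − 1)·c·C(n,k).
module Submission where

open import Defs
open import Data.Nat using (ℕ; zero; suc; _+_; _*_; _∸_; _≤_; _<_; z≤n; s≤s; z<s; NonZero; >-nonZero)
open import Data.Nat.Properties hiding (_≟_)
open import Data.Nat.Combinatorics using (_C_; nCk+nC[k+1]≡[n+1]C[k+1])
open import Algebra.Properties.CommutativeSemigroup +-commutativeSemigroup using (interchange; xy∙z≈xz∙y)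
open import Algebra.Properties.CommutativeSemigroup *-commutativeSemigroup
  using () renaming (x∙yz≈yx∙z to x*[y*z]≡y*x*z; xy∙z≈y∙zx to x*y*z≡y*[z*x])
open import Data.Bool using (if_then_else_)
import Data.Bool.Properties as Bool
open import Data.Fin using (Fin; zero; suc)
open import Data.Fin.Properties using (¬∀⟶∃¬)
open import Data.Fin.Subset using (Subset; inside; outside; ∣_∣; _∪_; ⊥; Empty)
open import Data.Fin.Subset.Properties using (∣p∣≤n; ∣⊥∣≡0; ∉⊥; Empty-unique; ∩-comm; x∈p∩q⁺; x∈p∩q⁻; x∈p∪q⁺)
open import Data.List using (List; []; _∷_; length)
open import Data.List.Membership.Propositional using (_∈_)
open import Data.List.Relation.Unary.All using (All; []; _∷_)
open import Data.List.Relation.Unary.AllPairs using ([]; _∷_)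
open import Data.List.Relation.Unary.Any using (here; there)
open import Data.List.Relation.Unary.Unique.Propositional using (Unique)
open import Data.Vec using (Vec; []; _∷_; lookup; sum; tabulate)
open import Data.Vec.Properties using (≡-dec; tabulate-cong)
open import Data.Product using (_×_; _,_; proj₁; proj₂)
open import Data.Sum using (inj₁; inj₂)
open import Relation.Binary.Definitions using (DecidableEquality)
open import Relation.Binary.PropositionalEquality
open import Relation.Nullary using (Dec; does; yes; no; ¬_; contradiction)

private
  variable
    n : ℕ

_≟_ : DecidableEquality (Subset n)
_≟_ = ≡-dec Bool._≟_

indicator : {P : Set} → Dec P → ℕ
indicator P? = if does P? then 1 else 0

Empty-outside∷ : {p : Subset n} → Empty p → Empty (outside ∷ p)
Empty-outside∷ p-empty rewrite Empty-unique p-empty = λ (_ , x∈⊥) → ∉⊥ x∈⊥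

Disjoint-sym : (A B : Subset n) → Disjoint A B → Disjoint B A
Disjoint-sym A B = subst Empty (∩-comm A B)

Disjoint-∪⁻ : (Y X B : Subset n) → Disjoint Y (X ∪ B) → Disjoint Y X × Disjoint Y B
Disjoint-∪⁻ Y X B Y#X∪B =
    (λ (x , x∈Y∩X) → let (x∈Y , x∈X) = x∈p∩q⁻ Y X x∈Y∩X in
                     Y#X∪B (x , x∈p∩q⁺ (x∈Y , x∈p∪q⁺ (inj₁ x∈X))))
  , (λ (x , x∈Y∩B) → let (x∈Y , x∈B) = x∈p∩q⁻ Y B x∈Y∩B in
                     Y#X∪B (x , x∈p∩q⁺ (x∈Y , x∈p∪q⁺ (inj₂ x∈B))))

-- sumAvoiding k X f = Σ { f B ∣ B ∩ X = ∅, ∣ B ∣ = k }, by recursion on the coordinates.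
sumAvoiding : ℕ → Subset n → (Subset n → ℕ) → ℕ
sumAvoiding k       (inside  ∷ X) f = sumAvoiding k X (λ B → f (outside ∷ B))
sumAvoiding zero    []            f = f []
sumAvoiding (suc k) []            f = 0
sumAvoiding zero    (outside ∷ X) f = sumAvoiding zero X (λ B → f (outside ∷ B))
sumAvoiding (suc k) (outside ∷ X) f =
  sumAvoiding (suc k) X (λ B → f (outside ∷ B)) + sumAvoiding k X (λ B → f (inside ∷ B))

sumAvoiding-cong : ∀ k (X : Subset n) {f g : Subset n → ℕ} →
                   (∀ B → f B ≡ g B) → sumAvoiding k X f ≡ sumAvoiding k X g
sumAvoiding-cong k       (inside  ∷ X) f≗g = sumAvoiding-cong k X (λ B → f≗g (outside ∷ B))
sumAvoiding-cong zero    []            f≗g = f≗g []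
sumAvoiding-cong (suc k) []            f≗g = refl
sumAvoiding-cong zero    (outside ∷ X) f≗g = sumAvoiding-cong zero X (λ B → f≗g (outside ∷ B))
sumAvoiding-cong (suc k) (outside ∷ X) f≗g =
  cong₂ _+_ (sumAvoiding-cong (suc k) X (λ B → f≗g (outside ∷ B)))
            (sumAvoiding-cong k X (λ B → f≗g (inside ∷ B)))

sumAvoiding-mono : ∀ k (X : Subset n) {f g : Subset n → ℕ} →
                   (∀ B → Disjoint B X → f B ≤ g B) → sumAvoiding k X f ≤ sumAvoiding k X g
sumAvoiding-mono k       (inside  ∷ X) f≤g =
  sumAvoiding-mono k X (λ B B#X → f≤g (outside ∷ B) (Empty-outside∷ B#X))
sumAvoiding-mono zero    []            f≤g = f≤g [] (λ ())
sumAvoiding-mono (suc k) []            f≤g = z≤n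
sumAvoiding-mono zero    (outside ∷ X) f≤g =
  sumAvoiding-mono zero X (λ B B#X → f≤g (outside ∷ B) (Empty-outside∷ B#X))
sumAvoiding-mono (suc k) (outside ∷ X) f≤g =
  +-mono-≤ (sumAvoiding-mono (suc k) X (λ B B#X → f≤g (outside ∷ B) (Empty-outside∷ B#X)))
           (sumAvoiding-mono k X (λ B B#X → f≤g (inside ∷ B) (Empty-outside∷ B#X)))

sumAvoiding-+ : ∀ k (X : Subset n) (f g : Subset n → ℕ) →
                sumAvoiding k X (λ B → f B + g B) ≡ sumAvoiding k X f + sumAvoiding k X g
sumAvoiding-+ k       (inside  ∷ X) f g = sumAvoiding-+ k X _ _
sumAvoiding-+ zero    []            f g = refl
sumAvoiding-+ (suc k) []            f g = refl
sumAvoiding-+ zero    (outside ∷ X) f g = sumAvoiding-+ zero X _ _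
sumAvoiding-+ (suc k) (outside ∷ X) f g =
  trans (cong₂ _+_ (sumAvoiding-+ (suc k) X _ _) (sumAvoiding-+ k X _ _))
        (interchange (sumAvoiding (suc k) X (λ B → f (outside ∷ B)))
                     (sumAvoiding (suc k) X (λ B → g (outside ∷ B)))
                     (sumAvoiding k X (λ B → f (inside ∷ B)))
                     (sumAvoiding k X (λ B → g (inside ∷ B))))

-- Every B in the sum has ∣ X ∪ B ∣ = ∣ X ∣ + k.
sumAvoiding-factor : ∀ k (X : Subset n) (h : ℕ → ℕ) (f : Subset n → ℕ) →
                     sumAvoiding k X (λ B → h ∣ X ∪ B ∣ * f B) ≡ h (∣ X ∣ + k) * sumAvoiding k X f
sumAvoiding-factor k       (inside  ∷ X) h f = sumAvoiding-factor k X (λ a → h (suc a)) _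
sumAvoiding-factor zero    []            h f = refl
sumAvoiding-factor (suc k) []            h f = sym (*-zeroʳ (h (suc k)))
sumAvoiding-factor zero    (outside ∷ X) h f = sumAvoiding-factor zero X h _
sumAvoiding-factor (suc k) (outside ∷ X) h f = begin
  sumAvoiding (suc k) X (λ B → h ∣ X ∪ B ∣ * f (outside ∷ B)) +
  sumAvoiding k X (λ B → h (suc ∣ X ∪ B ∣) * f (inside ∷ B))
    ≡⟨ cong₂ _+_ (sumAvoiding-factor (suc k) X h _) (sumAvoiding-factor k X (λ a → h (suc a)) _) ⟩
  h (∣ X ∣ + suc k) * sumAvoiding (suc k) X (λ B → f (outside ∷ B)) +
  h (suc (∣ X ∣ + k)) * sumAvoiding k X (λ B → f (inside ∷ B))
    ≡⟨ cong (λ a → h (∣ X ∣ + suc k) * sumAvoiding (suc k) X (λ B → f (outside ∷ B)) +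
                   h a * sumAvoiding k X (λ B → f (inside ∷ B))) (+-suc ∣ X ∣ k) ⟨
  h (∣ X ∣ + suc k) * sumAvoiding (suc k) X (λ B → f (outside ∷ B)) +
  h (∣ X ∣ + suc k) * sumAvoiding k X (λ B → f (inside ∷ B))
    ≡⟨ *-distribˡ-+ (h (∣ X ∣ + suc k)) _ _ ⟨
  h (∣ X ∣ + suc k) * sumAvoiding (suc k) (outside ∷ X) f
    ∎
  where open ≡-Reasoning

sumAvoiding-count : ∀ k (X : Subset n) → sumAvoiding k X (λ _ → 1) ≡ (n ∸ ∣ X ∣) C k
sumAvoiding-count k       (inside  ∷ X) = sumAvoiding-count k X
sumAvoiding-count zero    []            = refl
sumAvoiding-count (suc k) []            = refl
sumAvoiding-count zero    (outside ∷ X) = sumAvoiding-count zero X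
sumAvoiding-count {suc n} (suc k) (outside ∷ X) = begin
  sumAvoiding (suc k) X (λ _ → 1) + sumAvoiding k X (λ _ → 1)
    ≡⟨ cong₂ _+_ (sumAvoiding-count (suc k) X) (sumAvoiding-count k X) ⟩
  (n ∸ ∣ X ∣) C suc k + (n ∸ ∣ X ∣) C k
    ≡⟨ +-comm ((n ∸ ∣ X ∣) C suc k) _ ⟩
  (n ∸ ∣ X ∣) C k + (n ∸ ∣ X ∣) C suc k
    ≡⟨ nCk+nC[k+1]≡[n+1]C[k+1] (n ∸ ∣ X ∣) k ⟩
  suc (n ∸ ∣ X ∣) C suc k
    ≡⟨ cong (_C suc k) (+-∸-assoc 1 (∣p∣≤n X)) ⟨
  (suc n ∸ ∣ X ∣) C suc k
    ∎
  where open ≡-Reasoning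

sumAvoiding-card : ∀ k (X : Subset n) (h : ℕ → ℕ) →
                   sumAvoiding k X (λ B → h ∣ X ∪ B ∣) ≡ ((n ∸ ∣ X ∣) C k) * h (∣ X ∣ + k)
sumAvoiding-card {n} k X h = begin
  sumAvoiding k X (λ B → h ∣ X ∪ B ∣)       ≡⟨ sumAvoiding-cong k X (λ B → *-identityʳ (h ∣ X ∪ B ∣)) ⟨
  sumAvoiding k X (λ B → h ∣ X ∪ B ∣ * 1)   ≡⟨ sumAvoiding-factor k X h (λ _ → 1) ⟩
  h (∣ X ∣ + k) * sumAvoiding k X (λ _ → 1) ≡⟨ cong (h (∣ X ∣ + k) *_) (sumAvoiding-count k X) ⟩
  h (∣ X ∣ + k) * ((n ∸ ∣ X ∣) C k)         ≡⟨ *-comm (h (∣ X ∣ + k)) _ ⟩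
  ((n ∸ ∣ X ∣) C k) * h (∣ X ∣ + k)         ∎
  where open ≡-Reasoning

sumAvoiding-zero : ∀ k (X : Subset n) → sumAvoiding k X (λ _ → 0) ≡ 0
sumAvoiding-zero {n} k X = trans (sumAvoiding-card k X (λ _ → 0)) (*-zeroʳ ((n ∸ ∣ X ∣) C k))

-- At the first point outside X a disjoint pair (A , B) has one of three shapes (the point lies
-- in neither set, in A only, or in B only), so both sides split into three sums that match.
sumAvoiding-swap : ∀ a b (X : Subset n) (f : Subset n → Subset n → ℕ) →
                   sumAvoiding a X (λ A → sumAvoiding b (X ∪ A) (λ B → f A B)) ≡
                   sumAvoiding b X (λ B → sumAvoiding a (X ∪ B) (λ A → f A B))
sumAvoiding-swap a b (inside ∷ X) f =
  sumAvoiding-swap a b X (λ A B → f (outside ∷ A) (outside ∷ B))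
sumAvoiding-swap zero    zero    [] f = refl
sumAvoiding-swap zero    (suc b) [] f = refl
sumAvoiding-swap (suc a) zero    [] f = refl
sumAvoiding-swap (suc a) (suc b) [] f = refl
sumAvoiding-swap zero zero (outside ∷ X) f =
  sumAvoiding-swap zero zero X (λ A B → f (outside ∷ A) (outside ∷ B))
sumAvoiding-swap zero (suc b) (outside ∷ X) f =
  trans (sumAvoiding-+ zero X (λ A → sumAvoiding (suc b) (X ∪ A) (f₀₀ A))
                              (λ A → sumAvoiding b (X ∪ A) (f₀₁ A)))
        (cong₂ _+_ (sumAvoiding-swap zero (suc b) X f₀₀) (sumAvoiding-swap zero b X f₀₁))
  where f₀₀ f₀₁ : Subset _ → Subset _ → ℕ
        f₀₀ A B = f (outside ∷ A) (outside ∷ B)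
        f₀₁ A B = f (outside ∷ A) (inside ∷ B)
sumAvoiding-swap (suc a) zero (outside ∷ X) f =
  trans (cong₂ _+_ (sumAvoiding-swap (suc a) zero X f₀₀) (sumAvoiding-swap a zero X f₁₀))
        (sym (sumAvoiding-+ zero X (λ B → sumAvoiding (suc a) (X ∪ B) (λ A → f₀₀ A B))
                                   (λ B → sumAvoiding a (X ∪ B) (λ A → f₁₀ A B))))
  where f₀₀ f₁₀ : Subset _ → Subset _ → ℕ
        f₀₀ A B = f (outside ∷ A) (outside ∷ B)
        f₁₀ A B = f (inside ∷ A) (outside ∷ B)
sumAvoiding-swap (suc a) (suc b) (outside ∷ X) f = begin
  sumAvoiding (suc a) X (λ A → sumAvoiding (suc b) (X ∪ A) (f₀₀ A) + sumAvoiding b (X ∪ A) (f₀₁ A)) + R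
    ≡⟨ cong (_+ R) (sumAvoiding-+ (suc a) X _ _) ⟩
  P + Q + R
    ≡⟨ xy∙z≈xz∙y P Q R ⟩
  P + R + Q
    ≡⟨ cong₂ _+_ (cong₂ _+_ (sumAvoiding-swap (suc a) (suc b) X f₀₀) (sumAvoiding-swap a (suc b) X f₁₀))
                 (sumAvoiding-swap (suc a) b X f₀₁) ⟩
  P′ + R′ + Q′
    ≡⟨ cong (_+ Q′) (sumAvoiding-+ (suc b) X _ _) ⟨
  sumAvoiding (suc b) X (λ B → sumAvoiding (suc a) (X ∪ B) (λ A → f₀₀ A B)
                             + sumAvoiding a (X ∪ B) (λ A → f₁₀ A B)) + Q′
    ∎
  where
  open ≡-Reasoning
  f₀₀ f₀₁ f₁₀ : Subset _ → Subset _ → ℕ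
  f₀₀ A B = f (outside ∷ A) (outside ∷ B)
  f₀₁ A B = f (outside ∷ A) (inside ∷ B)
  f₁₀ A B = f (inside ∷ A) (outside ∷ B)
  P Q R P′ Q′ R′ : ℕ
  P = sumAvoiding (suc a) X (λ A → sumAvoiding (suc b) (X ∪ A) (f₀₀ A))
  Q = sumAvoiding (suc a) X (λ A → sumAvoiding b (X ∪ A) (f₀₁ A))
  R = sumAvoiding a X (λ A → sumAvoiding (suc b) (X ∪ A) (f₁₀ A))
  P′ = sumAvoiding (suc b) X (λ B → sumAvoiding (suc a) (X ∪ B) (λ A → f₀₀ A B))
  Q′ = sumAvoiding b X (λ B → sumAvoiding (suc a) (X ∪ B) (λ A → f₀₁ A B))
  R′ = sumAvoiding (suc b) X (λ B → sumAvoiding a (X ∪ B) (λ A → f₁₀ A B))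

PairwiseDisjoint : {m : ℕ} → Vec (Subset n) m → Set
PairwiseDisjoint t = ∀ i j → i ≢ j → Disjoint (lookup t i) (lookup t j)

∷-pairwiseDisjoint : ∀ {m} (X B : Subset n) (t : Vec (Subset n) m) → Disjoint B X →
                     (∀ i → Disjoint (lookup t i) (X ∪ B)) → PairwiseDisjoint t →
                     PairwiseDisjoint (B ∷ t)
∷-pairwiseDisjoint X B t B#X t#X∪B t-disj = λ where
  zero    zero    0≢0   → contradiction refl 0≢0
  zero    (suc j) _     → Disjoint-sym (lookup t j) B (proj₂ (Disjoint-∪⁻ (lookup t j) X B (t#X∪B j)))
  (suc i) zero    _     → proj₂ (Disjoint-∪⁻ (lookup t i) X B (t#X∪B i))
  (suc i) (suc j) i+1≢j+1 → t-disj i j (λ i≡j → i+1≢j+1 (cong suc i≡j))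

-- The sum of g over the ordered m-tuples of pairwise disjoint k-sets that avoid X.
sumMatchings : (k m : ℕ) → Subset n → (Vec (Subset n) m → ℕ) → ℕ
sumMatchings k zero    X g = g []
sumMatchings k (suc m) X g = sumAvoiding k X (λ B → sumMatchings k m (X ∪ B) (λ t → g (B ∷ t)))

-- The number of such tuples when r points are available.
matchingCount : (k m r : ℕ) → ℕ
matchingCount k zero    r = 1
matchingCount k (suc m) r = (r C k) * matchingCount k m (r ∸ k)

sumMatchings-mono : ∀ k m (X : Subset n) {f g : Vec (Subset n) m → ℕ} →
                    (∀ t → (∀ i → Disjoint (lookup t i) X) → PairwiseDisjoint t → f t ≤ g t) →
                    sumMatchings k m X f ≤ sumMatchings k m X g
sumMatchings-mono k zero    X f≤g = f≤g [] (λ ()) (λ ())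
sumMatchings-mono k (suc m) X f≤g =
  sumAvoiding-mono k X λ B B#X →
    sumMatchings-mono k m (X ∪ B) λ t t#X∪B t-disj →
      f≤g (B ∷ t) (λ where zero    → B#X
                           (suc i) → proj₁ (Disjoint-∪⁻ (lookup t i) X B (t#X∪B i)))
                  (∷-pairwiseDisjoint X B t B#X t#X∪B t-disj)

sumMatchings-const : ∀ k m (X : Subset n) (c : ℕ) →
                     sumMatchings k m X (λ _ → c) ≡ matchingCount k m (n ∸ ∣ X ∣) * c
sumMatchings-const k zero X c = sym (*-identityˡ c)
sumMatchings-const {n} k (suc m) X c = begin
  sumAvoiding k X (λ B → sumMatchings k m (X ∪ B) (λ _ → c))
    ≡⟨ sumAvoiding-cong k X (λ B → sumMatchings-const k m (X ∪ B) c) ⟩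
  sumAvoiding k X (λ B → matchingCount k m (n ∸ ∣ X ∪ B ∣) * c)
    ≡⟨ sumAvoiding-card k X (λ a → matchingCount k m (n ∸ a) * c) ⟩
  (r C k) * (matchingCount k m (n ∸ (∣ X ∣ + k)) * c)
    ≡⟨ cong (λ r′ → (r C k) * (matchingCount k m r′ * c)) (∸-+-assoc n ∣ X ∣ k) ⟨
  (r C k) * (matchingCount k m (r ∸ k) * c)
    ≡⟨ *-assoc (r C k) _ c ⟨
  (r C k) * matchingCount k m (r ∸ k) * c
    ∎
  where open ≡-Reasoning
        r : ℕ
        r = n ∸ ∣ X ∣

sumMatchings-+ : ∀ k m (X : Subset n) (f g : Vec (Subset n) m → ℕ) →
                 sumMatchings k m X (λ t → f t + g t) ≡ sumMatchings k m X f + sumMatchings k m X g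
sumMatchings-+ k zero    X f g = refl
sumMatchings-+ k (suc m) X f g =
  trans (sumAvoiding-cong k X (λ B → sumMatchings-+ k m (X ∪ B) _ _)) (sumAvoiding-+ k X _ _)

sumMatchings-sum : ∀ k m (X : Subset n) {s} (f : Fin s → Vec (Subset n) m → ℕ) →
                   sumMatchings k m X (λ t → sum (tabulate (λ i → f i t))) ≡
                   sum (tabulate (λ i → sumMatchings k m X (f i)))
sumMatchings-sum {n} k m X {zero} f =
  trans (sumMatchings-const k m X 0) (*-zeroʳ (matchingCount k m (n ∸ ∣ X ∣)))
sumMatchings-sum k m X {suc s} f =
  trans (sumMatchings-+ k m X (f zero) (λ t → sum (tabulate (λ i → f (suc i) t))))
        (cong (sumMatchings k m X (f zero) +_) (sumMatchings-sum k m X (λ i → f (suc i))))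

-- Each coordinate of a random matching is a uniformly distributed k-set: the first one by
-- definition, the others by exchanging two adjacent coordinates (sumAvoiding-swap).
sumMatchings-lookup : ∀ k m (X : Subset n) (j : Fin (suc m)) (h : Subset n → ℕ) →
                      sumMatchings k (suc m) X (λ t → h (lookup t j)) ≡
                      matchingCount k m (n ∸ ∣ X ∣ ∸ k) * sumAvoiding k X h
sumMatchings-lookup {n} k m X zero h = begin
  sumAvoiding k X (λ B → sumMatchings k m (X ∪ B) (λ _ → h B))
    ≡⟨ sumAvoiding-cong k X (λ B → sumMatchings-const k m (X ∪ B) (h B)) ⟩
  sumAvoiding k X (λ B → matchingCount k m (n ∸ ∣ X ∪ B ∣) * h B)
    ≡⟨ sumAvoiding-factor k X (λ a → matchingCount k m (n ∸ a)) h ⟩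
  matchingCount k m (n ∸ (∣ X ∣ + k)) * sumAvoiding k X h
    ≡⟨ cong (λ r → matchingCount k m r * sumAvoiding k X h) (∸-+-assoc n ∣ X ∣ k) ⟨
  matchingCount k m (n ∸ ∣ X ∣ ∸ k) * sumAvoiding k X h
    ∎
  where open ≡-Reasoning
sumMatchings-lookup {n} k (suc m) X (suc j) h = begin
  sumAvoiding k X (λ B → sumMatchings k (suc m) (X ∪ B) (λ t → h (lookup t j)))
    ≡⟨ sumAvoiding-cong k X (λ B → sumMatchings-lookup k m (X ∪ B) j h) ⟩
  sumAvoiding k X (λ B → matchingCount k m (n ∸ ∣ X ∪ B ∣ ∸ k) * sumAvoiding k (X ∪ B) h)
    ≡⟨ sumAvoiding-factor k X (λ a → matchingCount k m (n ∸ a ∸ k)) _ ⟩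
  matchingCount k m (n ∸ (∣ X ∣ + k) ∸ k) * sumAvoiding k X (λ B → sumAvoiding k (X ∪ B) h)
    ≡⟨ cong (matchingCount k m (n ∸ (∣ X ∣ + k) ∸ k) *_) (begin
         sumAvoiding k X (λ B → sumAvoiding k (X ∪ B) h)
           ≡⟨ sumAvoiding-swap k k X (λ _ B → h B) ⟩
         sumAvoiding k X (λ B → sumAvoiding k (X ∪ B) (λ _ → h B))
           ≡⟨ sumAvoiding-cong k X (λ B → sumAvoiding-card k (X ∪ B) (λ _ → h B)) ⟩
         sumAvoiding k X (λ B → ((n ∸ ∣ X ∪ B ∣) C k) * h B)
           ≡⟨ sumAvoiding-factor k X (λ a → (n ∸ a) C k) h ⟩
         ((n ∸ (∣ X ∣ + k)) C k) * sumAvoiding k X h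
           ∎) ⟩
  matchingCount k m (n ∸ (∣ X ∣ + k) ∸ k) * (((n ∸ (∣ X ∣ + k)) C k) * sumAvoiding k X h)
    ≡⟨ cong (λ r → matchingCount k m (r ∸ k) * ((r C k) * sumAvoiding k X h)) (∸-+-assoc n ∣ X ∣ k) ⟨
  matchingCount k m (r ∸ k) * ((r C k) * sumAvoiding k X h)
    ≡⟨ x*[y*z]≡y*x*z (matchingCount k m (r ∸ k)) (r C k) (sumAvoiding k X h) ⟩
  (r C k) * matchingCount k m (r ∸ k) * sumAvoiding k X h
    ∎
  where open ≡-Reasoning
        r : ℕ
        r = n ∸ ∣ X ∣ ∸ k

multiplicity : Subset n → List (Subset n) → ℕ
multiplicity B []      = 0
multiplicity B (F ∷ 𝓕) = indicator (B ≟ F) + multiplicity B 𝓕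

multiplicity-absent : (B : Subset n) (𝓕 : List (Subset n)) → All (B ≢_) 𝓕 → multiplicity B 𝓕 ≡ 0
multiplicity-absent B []      []            = refl
multiplicity-absent B (F ∷ 𝓕) (B≢F ∷ B∉𝓕) with B ≟ F
... | yes B≡F = contradiction B≡F B≢F
... | no  _   = multiplicity-absent B 𝓕 B∉𝓕

multiplicity≤1 : (B : Subset n) (𝓕 : List (Subset n)) → Unique 𝓕 → multiplicity B 𝓕 ≤ 1
multiplicity≤1 B []      []            = z≤n
multiplicity≤1 B (F ∷ 𝓕) (F∉𝓕 ∷ 𝓕-unique) with B ≟ F
... | yes refl = ≤-reflexive (cong suc (multiplicity-absent B 𝓕 F∉𝓕))
... | no  _    = multiplicity≤1 B 𝓕 𝓕-unique

multiplicity>0⇒∈ : (B : Subset n) (𝓕 : List (Subset n)) → 0 < multiplicity B 𝓕 → B ∈ 𝓕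
multiplicity>0⇒∈ B (F ∷ 𝓕) B∈𝓕 with B ≟ F
... | yes B≡F = here B≡F
... | no  _   = there (multiplicity>0⇒∈ B 𝓕 B∈𝓕)

sumAvoiding-indicator : ∀ k (A : Subset n) → ∣ A ∣ ≡ k → sumAvoiding k ⊥ (λ B → indicator (B ≟ A)) ≡ 1
sumAvoiding-indicator zero    []            refl = refl
sumAvoiding-indicator zero    (outside ∷ A) ∣A∣≡0 = sumAvoiding-indicator zero A ∣A∣≡0
sumAvoiding-indicator {suc n} (suc k) (outside ∷ A) ∣A∣≡k+1 =
  cong₂ _+_ (sumAvoiding-indicator (suc k) A ∣A∣≡k+1) (sumAvoiding-zero k (⊥ {n}))
sumAvoiding-indicator {suc n} (suc k) (inside  ∷ A) ∣A∣+1≡k+1 =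
  cong₂ _+_ (sumAvoiding-zero (suc k) (⊥ {n})) (sumAvoiding-indicator k A (suc-injective ∣A∣+1≡k+1))

sumAvoiding-multiplicity : ∀ k (𝓕 : List (Subset n)) → All (λ F → ∣ F ∣ ≡ k) 𝓕 →
                           sumAvoiding k ⊥ (λ B → multiplicity B 𝓕) ≡ length 𝓕
sumAvoiding-multiplicity {n} k []      []             = sumAvoiding-zero k (⊥ {n})
sumAvoiding-multiplicity k (F ∷ 𝓕) (∣F∣≡k ∷ 𝓕-k) =
  trans (sumAvoiding-+ k ⊥ (λ B → indicator (B ≟ F)) (λ B → multiplicity B 𝓕))
        (cong₂ _+_ (sumAvoiding-indicator k F ∣F∣≡k) (sumAvoiding-multiplicity k 𝓕 𝓕-k))

sum-tabulate-*ˡ : ∀ {s} c (a : Fin s → ℕ) → sum (tabulate (λ i → c * a i)) ≡ c * sum (tabulate a)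
sum-tabulate-*ˡ {zero}  c a = sym (*-zeroʳ c)
sum-tabulate-*ˡ {suc s} c a =
  trans (cong (c * a zero +_) (sum-tabulate-*ˡ c (λ i → a (suc i)))) (sym (*-distribˡ-+ c (a zero) _))

sum-tabulate-≤ : ∀ {s} c (a : Fin s → ℕ) → (∀ i → a i ≤ c) → sum (tabulate a) ≤ s * c
sum-tabulate-≤ {zero}  c a a≤c = z≤n
sum-tabulate-≤ {suc s} c a a≤c = +-mono-≤ (a≤c zero) (sum-tabulate-≤ c (λ i → a (suc i)) (λ i → a≤c (suc i)))

sum-tabulate≤pred : ∀ {s} (a : Fin s → ℕ) → (∀ i → a i ≤ 1) → ∀ i → a i ≡ 0 → sum (tabulate a) ≤ s ∸ 1
sum-tabulate≤pred {suc s} a a≤1 zero a₀≡0 = begin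
  a zero + sum (tabulate (λ i → a (suc i))) ≡⟨ cong (_+ sum (tabulate (λ i → a (suc i)))) a₀≡0 ⟩
  sum (tabulate (λ i → a (suc i)))          ≤⟨ sum-tabulate-≤ 1 (λ i → a (suc i)) (λ i → a≤1 (suc i)) ⟩
  s * 1                                     ≡⟨ *-identityʳ s ⟩
  s                                         ∎
  where open ≤-Reasoning
sum-tabulate≤pred {suc (suc s)} a a≤1 (suc i) aᵢ≡0 =
  +-mono-≤ (a≤1 zero) (sum-tabulate≤pred (λ i → a (suc i)) (λ i → a≤1 (suc i)) i aᵢ≡0)

hits : ∀ {s} → (Fin s → List (Subset n)) → Vec (Subset n) s → ℕ
hits 𝓕 t = sum (tabulate (λ i → multiplicity (lookup t i) (𝓕 i)))

crossDependent⇒hits≤ : ∀ {s} (𝓕 : Fin s → List (Subset n)) → (∀ i → Unique (𝓕 i)) → CrossDependent 𝓕 →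
                       (t : Vec (Subset n) s) → PairwiseDisjoint t → hits 𝓕 t ≤ s ∸ 1
crossDependent⇒hits≤ {s = s} 𝓕 𝓕-unique 𝓕-cd t t-disj =
  let (i , i-missed) = ¬∀⟶∃¬ s Hit (λ i → 0 <? multiplicity (lookup t i) (𝓕 i)) not-all-hit
  in sum-tabulate≤pred _ (λ i → multiplicity≤1 (lookup t i) (𝓕 i) (𝓕-unique i)) i (n≤0⇒n≡0 (≮⇒≥ i-missed))
  where
  Hit : Fin s → Set
  Hit i = 0 < multiplicity (lookup t i) (𝓕 i)
  not-all-hit : ¬ (∀ i → Hit i)
  not-all-hit all-hit = 𝓕-cd (lookup t , (λ i → multiplicity>0⇒∈ (lookup t i) (𝓕 i) (all-hit i)) , t-disj)

sumMatchings-hits : ∀ k m (𝓕 : Fin (suc m) → List (Subset n)) → (∀ i → All (λ F → ∣ F ∣ ≡ k) (𝓕 i)) →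
                    sumMatchings k (suc m) ⊥ (hits 𝓕) ≡ matchingCount k m (n ∸ k) * sum (tabulate (λ i → length (𝓕 i)))
sumMatchings-hits {n} k m 𝓕 𝓕-k = begin
  sumMatchings k (suc m) ⊥ (hits 𝓕)
    ≡⟨ sumMatchings-sum k (suc m) ⊥ (λ i t → multiplicity (lookup t i) (𝓕 i)) ⟩
  sum (tabulate (λ i → sumMatchings k (suc m) ⊥ (λ t → multiplicity (lookup t i) (𝓕 i))))
    ≡⟨ cong sum (tabulate-cong hits-of-𝓕ᵢ) ⟩
  sum (tabulate (λ i → matchingCount k m (n ∸ k) * length (𝓕 i)))
    ≡⟨ sum-tabulate-*ˡ (matchingCount k m (n ∸ k)) (λ i → length (𝓕 i)) ⟩
  matchingCount k m (n ∸ k) * sum (tabulate (λ i → length (𝓕 i)))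
    ∎
  where
  open ≡-Reasoning
  hits-of-𝓕ᵢ : ∀ i → sumMatchings k (suc m) ⊥ (λ t → multiplicity (lookup t i) (𝓕 i)) ≡
                      matchingCount k m (n ∸ k) * length (𝓕 i)
  hits-of-𝓕ᵢ i =
    trans (sumMatchings-lookup k m ⊥ i (λ B → multiplicity B (𝓕 i)))
          (cong₂ (λ a ℓ → matchingCount k m (n ∸ a ∸ k) * ℓ) (∣⊥∣≡0 n) (sumAvoiding-multiplicity k (𝓕 i) (𝓕-k i)))

nCk>0 : ∀ {r k} → k ≤ r → 0 < r C k
nCk>0 {r}     {zero}  _         = z<s
nCk>0 {suc r} {suc k} (s≤s k≤r) = <-≤-trans (nCk>0 k≤r) (begin
  r C k                    ≤⟨ m≤m+n (r C k) (r C suc k) ⟩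
  r C k + r C suc k        ≡⟨ nCk+nC[k+1]≡[n+1]C[k+1] r k ⟩
  suc r C suc k            ∎)
  where open ≤-Reasoning

matchingCount≢0 : ∀ k m {r} → m * k ≤ r → NonZero (matchingCount k m r)
matchingCount≢0 k zero    _     = _
matchingCount≢0 k (suc m) {r} mk≤r =
  m*n≢0 (r C k) (matchingCount k m (r ∸ k))
    {{>-nonZero (nCk>0 (m+n≤o⇒m≤o k mk≤r))}}
    {{matchingCount≢0 k m (m+n≤o⇒m≤o∸n (m * k) (subst (_≤ r) (+-comm k (m * k)) mk≤r))}}

mainTheorem8 : (n k s : ℕ) → s * k ≤ n →
    (𝓕 : Fin s → List (Subset n)) →
    ((i : Fin s) → IsKFamily n k (𝓕 i)) →
    CrossDependent 𝓕 →
    sum (tabulate (λ i → length (𝓕 i))) ≤ (s ∸ 1) * (n C k)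
mainTheorem8 n k zero    _    𝓕 𝓕-fam 𝓕-cd = z≤n
mainTheorem8 n k (suc s) sk≤n 𝓕 𝓕-fam 𝓕-cd = *-cancelˡ-≤ c {{c≢0}} (begin
  c * sum (tabulate (λ i → length (𝓕 i)))    ≡⟨ sumMatchings-hits k s 𝓕 (λ i → proj₂ (𝓕-fam i)) ⟨
  sumMatchings k (suc s) ∅ (hits 𝓕)           ≤⟨ sumMatchings-mono k (suc s) ∅ (λ t _ t-disj →
                                                   crossDependent⇒hits≤ 𝓕 (λ i → proj₁ (𝓕-fam i)) 𝓕-cd t t-disj) ⟩
  sumMatchings k (suc s) ∅ (λ _ → s)          ≡⟨ sumMatchings-const k (suc s) ∅ s ⟩
  matchingCount k (suc s) (n ∸ ∣ ∅ ∣) * s     ≡⟨ cong (λ a → matchingCount k (suc s) (n ∸ a) * s) (∣⊥∣≡0 n) ⟩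
  (n C k) * c * s                             ≡⟨ x*y*z≡y*[z*x] (n C k) c s ⟩
  c * (s * (n C k))                           ∎)
  where
  open ≤-Reasoning
  ∅ : Subset n
  ∅ = ⊥
  c : ℕ
  c = matchingCount k s (n ∸ k)
  c≢0 : NonZero c
  c≢0 = m*n≢0⇒n≢0 (n C k) {{matchingCount≢0 k (suc s) sk≤n}}
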